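{- Let $H^*$ be a graph and let $A, B \subseteq V(H^*)$ be disjoint sets such that every vertex of $A$ is isolated in $H^*$ and $B$ has the robust sapphire property for $H^*$. Let $F \subseteq \{ab \colon a \in A, b \in B\}$ and $H \coloneqq (V(H^*), E(H^*) \cup F)$. Let $B_{=1} \coloneqq \{b \in B \colon |N_H(b) \cap A| =1\}$, $A' \coloneqq \{a \in A \colon d_H(a) \geq 4,\ N_H(a) \subseteq B_{=1}\}$, and $B' \coloneqq N_H(A \setminus A')$. Then $(S(H^*) \setminus B') \cup A' \subseteq S(H)$. In addition, $B \setminus N_H(A)$ has the robust sapphire property for $H$.
   Context: All graphs are finite and simple. For a graph $G$ and $X \subseteq V(G)$, $N_G(X) \coloneqq \{y \in V(G)\setminus X \colon y \text{ has a neighbour in } X\}$ is the external neighbourhood, $N_G(x) \coloneqq N_G(\{x\})$, $d_G(x)$ is the degree and $\mathrm{dist}_G$ is graph distance. A set $X \subseteq V(G)$ has the strong $4$-core property for $G$ if $|N_G(x) \cap X| \geq 4$ for every $x \in X \cup N_G(X)$; the strong $4$-core $S(G)$ is the largest set with this property (the union of all such sets, which again has the property). A set $B \subseteq V(G)$ has the robust sapphire property for $G$ if (RS1) for every $x \in B \cup N_G(B)$ we have $\{x\} \cup N_G(x) \subseteq S(G)$ and $d_G(x) \geq 5$, and (RS2) $\mathrm{dist}_G(b_1,b_2) \geq 5$ for all distinct $b_1, b_2 \in B$. -}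

module Defs where

open import Data.Nat using (ℕ; zero; suc; _≤_; _≡ᵇ_; _≤ᵇ_)
open import Data.Bool using (Bool; true; false; not; _∧_; _∨_)
open import Data.Fin using (Fin)
open import Data.Fin.Subset using (Subset; _∈_; _∉_; _∩_; _∪_; ∁; ∣_∣)
open import Data.Vec using (tabulate; lookup)
open import Data.List using (allFin)
open import Data.Bool.ListAction using (any; all)
open import Data.Product using (Σ; _×_; ∃)
open import Relation.Binary.PropositionalEquality using (_≡_; _≢_)
open import Relation.Nullary using (¬_)

record Graph (n : ℕ) : Set where
  field
    adj    : Fin n → Fin n → Bool
    sym    : ∀ x y → adj x y ≡ adj y x
    irrefl : ∀ x → adj x x ≡ false
open Graph public

module _ {n : ℕ} where

  anyFin : (Fin n → Bool) → Bool
  anyFin f = any f (allFin n)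

  allFin? : (Fin n → Bool) → Bool
  allFin? f = all f (allFin n)

  Nbr : Graph n → Fin n → Subset n
  Nbr G x = tabulate (adj G x)

  NbrSet : Graph n → Subset n → Subset n
  NbrSet G X = tabulate λ y → not (lookup X y) ∧ anyFin (λ x → lookup X x ∧ adj G x y)

  deg : Graph n → Fin n → ℕ
  deg G x = ∣ Nbr G x ∣

  StrongCoreProp : Graph n → Subset n → Set
  StrongCoreProp G X = ∀ x → x ∈ (X ∪ NbrSet G X) → 4 ≤ ∣ Nbr G x ∩ X ∣

  InS : Graph n → Fin n → Set
  InS G x = Σ (Subset n) λ X → StrongCoreProp G X × x ∈ X

  data Walk (G : Graph n) : ℕ → Fin n → Fin n → Set where
    here : ∀ {x} → Walk G zero x x
    step : ∀ {k x y z} → adj G x y ≡ true → Walk G k y z → Walk G (suc k) x z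

  DistGe5 : Graph n → Fin n → Fin n → Set
  DistGe5 G x y = ∀ k → k ≤ 4 → ¬ Walk G k x y

  RobustSapphire : Graph n → Subset n → Set
  RobustSapphire G B =
    (∀ x → x ∈ (B ∪ NbrSet G B) →
       (InS G x × (∀ y → y ∈ Nbr G x → InS G y)) × 5 ≤ deg G x)
    × (∀ b₁ b₂ → b₁ ∈ B → b₂ ∈ B → b₁ ≢ b₂ → DistGe5 G b₁ b₂)

  Beq1 : Graph n → Subset n → Subset n → Subset n
  Beq1 H A B = tabulate λ b → lookup B b ∧ (∣ Nbr H b ∩ A ∣ ≡ᵇ 1)

  A′ : Graph n → Subset n → Subset n → Subset n
  A′ H A B = tabulate λ a → lookup A a ∧ (4 ≤ᵇ deg H a)
                 ∧ allFin? (λ y → not (adj H a y) ∨ lookup (Beq1 H A B) y)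

  B′ : Graph n → Subset n → Subset n → Subset n
  B′ H A B = NbrSet H (A ∩ ∁ (A′ H A B))

-- Let N[N[B]] be the closed second neighbourhood of B in H*. By the robust sapphire property it
-- lies in S(H*), so some set U with the strong 4-core property for H* contains it together with any
-- given such set. Then (U ∖ B′) ∪ A′ has the strong 4-core property for H: a vertex of A′ has at
-- least 4 neighbours, all in B₌₁ ⊆ U and none in B′, since its only neighbour in A is itself in A′;
-- a vertex of A ∖ A′ is neither in U (it is isolated in H*) nor next to the set (its neighbours
-- are in B′); a vertex of N_{H*}[B] has at least 5 H*-neighbours, all in U, and by the distance
-- condition at most one of them lies in B ⊇ B′; every other vertex sees only H*-edges and keeps its
-- 4 neighbours in U, none of which can lie in B′ ⊆ B.
-- For the second part, N_H[B ∖ N_H(A)] and its neighbours lie in N[N[B]] ∖ B′, and an H-walk between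
-- two vertices of B ∖ N_H(A) either avoids A, so is an H*-walk, or has a proper prefix that is an
-- H*-walk into N_H(A) ⊆ B; in both cases the distance condition in H* forbids length ≤ 4.

{-# OPTIONS --safe #-}
module Submission where

open import Defs hiding (sym)
open import Data.Bool using (Bool; true; false; not; _∧_; _∨_)
open import Data.Bool.Properties using (not-¬; T-≡; ∧-conicalˡ; ∧-conicalʳ; ¬-not)
open import Data.Empty using (⊥-elim)
open import Data.Fin using (Fin) renaming (_≟_ to _≟ᶠ_)
open import Data.Fin.Subset using (Subset; _∈_; _∉_; _⊆_; _∩_; _∪_; ∁; ∣_∣; ⁅_⁆; _-_; outside; inside)
  renaming (⊥ to ∅)
open import Data.Fin.Subset.Properties
  using (_∈?_; ∉⊥; x∈p∪q⁺; x∈p∪q⁻; x∈⁅x⁆; x∈p∩q⁺; x∈p∩q⁻; p⊆p∪q; q⊆p∪q; x∈∁p⇒x∉p; x∉p⇒x∈∁p; p⊆q⇒∣p∣≤∣q∣;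
         ∣p∣≤∣x∷p∣; ∣⊥∣≡0; ∣⁅x⁆∣≡1; x∈⁅y⁆⇒x≡y; x∈p∧x≢y⇒x∈p-y; x∈p⇒∣p-x∣<∣p∣)
open import Data.List using ([]; _∷_; allFin)
open import Data.List.Membership.Propositional using () renaming (_∈_ to _∈ₗ_)
open import Data.List.Membership.Propositional.Properties using (∈-allFin)
open import Data.List.Relation.Unary.All as All using ()
open import Data.List.Relation.Unary.All.Properties using (all⁺)
open import Data.List.Relation.Unary.Any as Any using (here; there)
open import Data.List.Relation.Unary.Any.Properties using (any⁺; any⁻)
open import Data.Nat using (ℕ; suc; _+_; _≤_; _<_; z≤n; s≤s)
open import Data.Nat.Properties
  using (<⇒≤; <⇒≱; ≤-pred; ≤ᵇ⇒≤; ≡ᵇ⇒≡; ≤-reflexive; ≤-trans; +-suc; +-monoʳ-≤; module ≤-Reasoning)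
open import Data.Product using (Σ; ∃-syntax; _×_; _,_; proj₁; proj₂)
open import Data.Sum as Sum using (_⊎_; inj₁; inj₂; [_,_])
open import Data.Vec using ([]; _∷_; lookup; tabulate)
open import Data.Vec.Properties using ([]=⇒lookup; lookup⇒[]=; lookup∘tabulate)
open import Function using (_∘_; Equivalence)
open import Relation.Nullary using (¬_; yes; no; contradiction)
open import Relation.Binary.PropositionalEquality using (_≡_; _≢_; refl; sym; trans; cong; cong₂)

private variable
  n : ℕ

∉⇒lookup≡false : ∀ {p : Subset n} {x} → x ∉ p → lookup p x ≡ false
∉⇒lookup≡false {p = p} {x} x∉p = ¬-not (x∉p ∘ lookup⇒[]= x p)

∈-tabulate⁺ : ∀ {f : Fin n → Bool} {x} → f x ≡ true → x ∈ tabulate f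
∈-tabulate⁺ {f = f} {x} fx = lookup⇒[]= x (tabulate f) (trans (lookup∘tabulate f x) fx)

∈-tabulate⁻ : ∀ {f : Fin n → Bool} {x} → x ∈ tabulate f → f x ≡ true
∈-tabulate⁻ {f = f} {x} x∈ = trans (sym (lookup∘tabulate f x)) ([]=⇒lookup x∈)

anyFin⁺ : ∀ (f : Fin n → Bool) x → f x ≡ true → anyFin f ≡ true
anyFin⁺ {n} f x fx =
  Equivalence.to T-≡ (any⁺ f (Any.map (λ { refl → Equivalence.from T-≡ fx }) (∈-allFin {n} x)))

anyFin⁻ : ∀ (f : Fin n → Bool) → anyFin f ≡ true → ∃[ x ] f x ≡ true
anyFin⁻ {n} f any-f with Any.satisfied (any⁻ f (allFin n) (Equivalence.from T-≡ any-f))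
... | x , fx = x , Equivalence.to T-≡ fx

allFin?⁻ : ∀ (f : Fin n → Bool) → allFin? f ≡ true → ∀ x → f x ≡ true
allFin?⁻ f all-f x =
  Equivalence.to T-≡ (All.lookup (all⁺ f _ (Equivalence.from T-≡ all-f)) (∈-allFin x))

x∈p∖q⁺ : ∀ {p q : Subset n} {x} → x ∈ p → x ∉ q → x ∈ p ∩ ∁ q
x∈p∖q⁺ x∈p x∉q = x∈p∩q⁺ (x∈p , x∉p⇒x∈∁p x∉q)

x∈p∖q⁻ : ∀ (p q : Subset n) {x} → x ∈ p ∩ ∁ q → x ∈ p × x ∉ q
x∈p∖q⁻ p q x∈ with x∈p∩q⁻ p (∁ q) x∈
... | x∈p , x∈∁q = x∈p , x∈∁p⇒x∉p x∈∁q

∣p∪q∣≤∣p∣+∣q∣ : ∀ (p q : Subset n) → ∣ p ∪ q ∣ ≤ ∣ p ∣ + ∣ q ∣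
∣p∪q∣≤∣p∣+∣q∣ []            []            = z≤n
∣p∪q∣≤∣p∣+∣q∣ (outside ∷ p) (outside ∷ q) = ∣p∪q∣≤∣p∣+∣q∣ p q
∣p∪q∣≤∣p∣+∣q∣ (outside ∷ p) (inside  ∷ q) rewrite +-suc ∣ p ∣ ∣ q ∣ = s≤s (∣p∪q∣≤∣p∣+∣q∣ p q)
∣p∪q∣≤∣p∣+∣q∣ (inside  ∷ p) (s       ∷ q) =
  s≤s (≤-trans (∣p∪q∣≤∣p∣+∣q∣ p q) (+-monoʳ-≤ ∣ p ∣ (∣p∣≤∣x∷p∣ s q)))

p⊆⁅x⁆∪q⇒∣p∣≤1+∣q∣ : ∀ {p q : Subset n} x → p ⊆ ⁅ x ⁆ ∪ q → ∣ p ∣ ≤ suc ∣ q ∣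
p⊆⁅x⁆∪q⇒∣p∣≤1+∣q∣ {p = p} {q} x p⊆ = begin
  ∣ p ∣               ≤⟨ p⊆q⇒∣p∣≤∣q∣ p⊆ ⟩
  ∣ ⁅ x ⁆ ∪ q ∣       ≤⟨ ∣p∪q∣≤∣p∣+∣q∣ ⁅ x ⁆ q ⟩
  ∣ ⁅ x ⁆ ∣ + ∣ q ∣   ≡⟨ cong (_+ ∣ q ∣) (∣⁅x⁆∣≡1 x) ⟩
  suc ∣ q ∣           ∎
  where open ≤-Reasoning

∣p∣≤1∧x∈p∧y∈p⇒x≡y : ∀ {p : Subset n} {x y} → ∣ p ∣ ≤ 1 → x ∈ p → y ∈ p → x ≡ y
∣p∣≤1∧x∈p∧y∈p⇒x≡y {p = p} {x} {y} ∣p∣≤1 x∈p y∈p with x ≟ᶠ y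
... | yes x≡y = x≡y
... | no  x≢y = contradiction ∣p∣≤1 (<⇒≱ (begin-strict
  1              ≡⟨ sym (∣⁅x⁆∣≡1 y) ⟩
  ∣ ⁅ y ⁆ ∣      ≤⟨ p⊆q⇒∣p∣≤∣q∣ ⁅y⁆⊆p-x ⟩
  ∣ p - x ∣      <⟨ x∈p⇒∣p-x∣<∣p∣ x∈p ⟩
  ∣ p ∣          ∎))
  where
  open ≤-Reasoning
  ⁅y⁆⊆p-x : ⁅ y ⁆ ⊆ p - x
  ⁅y⁆⊆p-x z∈⁅y⁆ with x∈⁅y⁆⇒x≡y y z∈⁅y⁆
  ... | refl = x∈p∧x≢y⇒x∈p-y y∈p (x≢y ∘ sym)

ClosedNbr : Graph n → Subset n → Subset n
ClosedNbr G X = X ∪ NbrSet G X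

module _ (G : Graph n) where

  adj-sym : ∀ {x y} → adj G x y ≡ true → adj G y x ≡ true
  adj-sym {x} {y} = trans (Graph.sym G y x)

  adj⇒≢ : ∀ {x y} → adj G x y ≡ true → x ≢ y
  adj⇒≢ {x} e refl with trans (sym (irrefl G x)) e
  ... | ()

  ∈Nbr⁺ : ∀ {x y} → adj G x y ≡ true → y ∈ Nbr G x
  ∈Nbr⁺ = ∈-tabulate⁺

  ∈Nbr⁻ : ∀ {x y} → y ∈ Nbr G x → adj G x y ≡ true
  ∈Nbr⁻ = ∈-tabulate⁻

  ∈NbrSet⁺ : ∀ {X : Subset n} {x z} → x ∉ X → z ∈ X → adj G z x ≡ true → x ∈ NbrSet G X
  ∈NbrSet⁺ {X} {x} {z} x∉X z∈X e = ∈-tabulate⁺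
    (cong₂ _∧_ (cong not (∉⇒lookup≡false x∉X))
               (anyFin⁺ (λ w → lookup X w ∧ adj G w x) z (cong₂ _∧_ ([]=⇒lookup z∈X) e)))

  ∈NbrSet⁻ : ∀ {X : Subset n} {x} → x ∈ NbrSet G X → x ∉ X × ∃[ z ] z ∈ X × adj G z x ≡ true
  ∈NbrSet⁻ {X} {x} x∈ = x∉X , z , lookup⇒[]= z X (∧-conicalˡ _ _ z∈X∧e) , ∧-conicalʳ _ _ z∈X∧e
    where
    x∈N = ∈-tabulate⁻ x∈
    x∉X : x ∉ X
    x∉X x∈X with trans (cong not (sym ([]=⇒lookup x∈X))) (∧-conicalˡ _ _ x∈N)
    ... | ()
    witness = anyFin⁻ (λ w → lookup X w ∧ adj G w x) (∧-conicalʳ _ _ x∈N)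
    z = proj₁ witness
    z∈X∧e = proj₂ witness

  ∈ClosedNbr : ∀ {X : Subset n} {x z} → z ∈ X → adj G z x ≡ true → x ∈ ClosedNbr G X
  ∈ClosedNbr {X} {x} z∈X e with x ∈? X
  ... | yes x∈X = x∈p∪q⁺ (inj₁ x∈X)
  ... | no  x∉X = x∈p∪q⁺ (inj₂ (∈NbrSet⁺ x∉X z∈X e))

  ∈ClosedNbr⁻ : ∀ {X : Subset n} {x} → x ∈ ClosedNbr G X → x ∈ X ⊎ ∃[ z ] z ∈ X × adj G z x ≡ true
  ∈ClosedNbr⁻ {X} x∈ = Sum.map₂ (proj₂ ∘ ∈NbrSet⁻) (x∈p∪q⁻ X (NbrSet G X) x∈)

  ClosedNbr-∪⁻ : ∀ {X Y : Subset n} {x} → x ∈ ClosedNbr G (X ∪ Y) → x ∈ ClosedNbr G X ⊎ x ∈ ClosedNbr G Y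
  ClosedNbr-∪⁻ {X} {Y} x∈ with ∈ClosedNbr⁻ x∈
  ... | inj₁ x∈X∪Y = Sum.map (x∈p∪q⁺ ∘ inj₁) (x∈p∪q⁺ ∘ inj₁) (x∈p∪q⁻ X Y x∈X∪Y)
  ... | inj₂ (z , z∈X∪Y , e) =
    Sum.map (λ z∈X → ∈ClosedNbr z∈X e) (λ z∈Y → ∈ClosedNbr z∈Y e) (x∈p∪q⁻ X Y z∈X∪Y)

  DistGe5⇒¬adj : ∀ {x y} → DistGe5 G x y → ¬ adj G x y ≡ true
  DistGe5⇒¬adj d e = d 1 (s≤s z≤n) (step e here)

  DistGe5⇒¬commonNbr : ∀ {x y z} → DistGe5 G x y → adj G x z ≡ true → ¬ adj G z y ≡ true
  DistGe5⇒¬commonNbr d e₁ e₂ = d 2 (s≤s (s≤s z≤n)) (step e₁ (step e₂ here))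

  StrongCoreProp-∅ : StrongCoreProp G ∅
  StrongCoreProp-∅ x x∈ = ⊥-elim ([ ∉⊥ , ∉⊥ ∘ proj₁ ∘ proj₂ ] (∈ClosedNbr⁻ x∈))

  StrongCoreProp-∪ : ∀ {X Y : Subset n} →
                     StrongCoreProp G X → StrongCoreProp G Y → StrongCoreProp G (X ∪ Y)
  StrongCoreProp-∪ {X} {Y} coreX coreY x x∈ =
    [ enlarge coreX (p⊆p∪q Y) , enlarge coreY (q⊆p∪q X Y) ] (ClosedNbr-∪⁻ x∈)
    where
    enlarge : ∀ {Z} → StrongCoreProp G Z → Z ⊆ X ∪ Y → x ∈ ClosedNbr G Z → 4 ≤ ∣ Nbr G x ∩ (X ∪ Y) ∣
    enlarge {Z} coreZ Z⊆X∪Y x∈Z = ≤-trans (coreZ x x∈Z) (p⊆q⇒∣p∣≤∣q∣ λ y∈ →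
      let y∈N , y∈Z = x∈p∩q⁻ (Nbr G x) Z y∈ in x∈p∩q⁺ (y∈N , Z⊆X∪Y y∈Z))

  StrongCoreProp⇒has-nbr : ∀ {X : Subset n} {x} → StrongCoreProp G X → x ∈ ClosedNbr G X →
                           ¬ (∀ y → adj G x y ≡ false)
  StrongCoreProp⇒has-nbr {X} {x} core x∈ isolated with ≤-trans (core x x∈) (≤-trans
      (p⊆q⇒∣p∣≤∣q∣ {q = ∅} λ y∈ →
        contradiction (∈Nbr⁻ (proj₁ (x∈p∩q⁻ (Nbr G x) X y∈))) (not-¬ (isolated _)))
      (≤-reflexive (∣⊥∣≡0 n)))
  ... | ()

  InS-cover : ∀ (P : Subset n) → (∀ {x} → x ∈ P → InS G x) →
              Σ (Subset n) λ X → StrongCoreProp G X × P ⊆ X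
  InS-cover P P⊆S with cover (allFin n)
    where
    cover : ∀ vs → Σ (Subset n) λ X → StrongCoreProp G X × (∀ {x} → x ∈ P → x ∈ₗ vs → x ∈ X)
    cover []       = ∅ , StrongCoreProp-∅ , λ _ ()
    cover (v ∷ vs) with cover vs | v ∈? P
    ... | X , core , cov | no v∉P =
      X , core , λ { x∈P (here refl) → ⊥-elim (v∉P x∈P) ; x∈P (there x∈vs) → cov x∈P x∈vs }
    ... | X , core , cov | yes v∈P with P⊆S v∈P
    ... | Xᵥ , coreᵥ , v∈Xᵥ = Xᵥ ∪ X , StrongCoreProp-∪ coreᵥ core ,
      λ { x∈P (here refl) → x∈p∪q⁺ (inj₁ v∈Xᵥ) ; x∈P (there x∈vs) → x∈p∪q⁺ (inj₂ (cov x∈P x∈vs)) }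
  ... | X , core , cov = X , core , λ x∈P → cov x∈P (∈-allFin _)

module _ (H : Graph n) (A B : Subset n) where

  ∈Beq1⁻ : ∀ {b} → b ∈ Beq1 H A B → b ∈ B × ∣ Nbr H b ∩ A ∣ ≡ 1
  ∈Beq1⁻ {b} b∈ with ∈-tabulate⁻ b∈
  ... | e = lookup⇒[]= b B (∧-conicalˡ _ _ e) , ≡ᵇ⇒≡ _ 1 (Equivalence.from T-≡ (∧-conicalʳ _ _ e))

  ∈A′⁻ : ∀ {a} → a ∈ A′ H A B →
         a ∈ A × 4 ≤ deg H a × (∀ {y} → adj H a y ≡ true → y ∈ Beq1 H A B)
  ∈A′⁻ {a} a∈ =
    lookup⇒[]= a A (∧-conicalˡ _ _ e) ,
    ≤ᵇ⇒≤ 4 (deg H a) (Equivalence.from T-≡ (∧-conicalˡ _ _ e′)) ,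
    λ {y} adj-ay → lookup⇒[]= y (Beq1 H A B)
      (trans (cong (λ b → not b ∨ lookup (Beq1 H A B) y) (sym adj-ay))
             (allFin?⁻ _ (∧-conicalʳ _ _ e′) y))
    where
    e = ∈-tabulate⁻ a∈
    e′ = ∧-conicalʳ (lookup A a) _ e

module _ (H* H : Graph n) (F : Fin n → Fin n → Bool)
  (H≡H*∪F : ∀ x y → adj H x y ≡ (adj H* x y ∨ F x y ∨ F y x)) where

  adj-∪ˡ : ∀ {x y} → adj H* x y ≡ true → adj H x y ≡ true
  adj-∪ˡ {x} {y} e rewrite H≡H*∪F x y | e = refl

  adj-∪⁻ : ∀ {x y} → adj H x y ≡ true → adj H* x y ≡ true ⊎ F x y ≡ true ⊎ F y x ≡ true
  adj-∪⁻ {x} {y} e rewrite H≡H*∪F x y with adj H* x y | F x y | F y x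
  ... | true  | _     | _    = inj₁ refl
  ... | false | true  | _    = inj₂ (inj₁ refl)
  ... | false | false | true = inj₂ (inj₂ refl)

module Augmentation
  {n : ℕ} (H* H : Graph n) (A B : Subset n)
  (A∩B≡∅ : ∀ x → x ∈ A → x ∉ B)
  (A-isolated : ∀ a → a ∈ A → ∀ y → adj H* a y ≡ false)
  (sapphire : RobustSapphire H* B)
  (H*⊆H : ∀ {x y} → adj H* x y ≡ true → adj H x y ≡ true)
  (H⊆H*∪AB : ∀ {x y} → adj H x y ≡ true →
             adj H* x y ≡ true ⊎ (x ∈ A × y ∈ B) ⊎ (y ∈ A × x ∈ B))
  where

  N[B] : Subset n
  N[B] = ClosedNbr H* B

  adj*⇒∉A : ∀ {x y} → adj H* x y ≡ true → x ∉ A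
  adj*⇒∉A {x} {y} e x∈A = not-¬ (A-isolated x x∈A y) e

  adj⇒adj*-∉A : ∀ {x y} → adj H x y ≡ true → x ∉ A → y ∉ A → adj H* x y ≡ true
  adj⇒adj*-∉A e x∉A y∉A with H⊆H*∪AB e
  ... | inj₁ e*              = e*
  ... | inj₂ (inj₁ (x∈A , _)) = ⊥-elim (x∉A x∈A)
  ... | inj₂ (inj₂ (y∈A , _)) = ⊥-elim (y∉A y∈A)

  adj⇒adj*-∉A∪B : ∀ {x y} → adj H x y ≡ true → x ∉ A → x ∉ B → adj H* x y ≡ true
  adj⇒adj*-∉A∪B e x∉A x∉B with H⊆H*∪AB e
  ... | inj₁ e*              = e*
  ... | inj₂ (inj₁ (x∈A , _)) = ⊥-elim (x∉A x∈A)
  ... | inj₂ (inj₂ (_ , x∈B)) = ⊥-elim (x∉B x∈B)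

  adj-A⇒∈B : ∀ {a y} → adj H a y ≡ true → a ∈ A → y ∈ B
  adj-A⇒∈B {a} {y} e a∈A with H⊆H*∪AB e
  ... | inj₁ e*              = ⊥-elim (adj*⇒∉A e* a∈A)
  ... | inj₂ (inj₁ (_ , y∈B)) = y∈B
  ... | inj₂ (inj₂ (_ , a∈B)) = ⊥-elim (A∩B≡∅ a a∈A a∈B)

  NbrSet-A⊆B : ∀ {X} → X ⊆ A → NbrSet H X ⊆ B
  NbrSet-A⊆B X⊆A y∈ with ∈NbrSet⁻ H y∈
  ... | _ , a , a∈X , e = adj-A⇒∈B e (X⊆A a∈X)

  B′⊆B : B′ H A B ⊆ B
  B′⊆B = NbrSet-A⊆B (λ a∈ → proj₁ (x∈p∖q⁻ A (A′ H A B) a∈))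

  B′⊆NbrSet-A : B′ H A B ⊆ NbrSet H A
  B′⊆NbrSet-A y∈ with ∈NbrSet⁻ H y∈
  ... | _ , a , a∈ , e =
    ∈NbrSet⁺ H (λ y∈A → A∩B≡∅ _ y∈A (B′⊆B y∈)) (proj₁ (x∈p∖q⁻ A (A′ H A B) a∈)) e

  B-far : ∀ {b₁ b₂} → b₁ ∈ B → b₂ ∈ B → b₁ ≢ b₂ → DistGe5 H* b₁ b₂
  B-far b₁∈B b₂∈B = proj₂ sapphire _ _ b₁∈B b₂∈B

  B-independent : ∀ {b₁ b₂} → b₁ ∈ B → b₂ ∈ B → ¬ adj H* b₁ b₂ ≡ true
  B-independent b₁∈B b₂∈B e = DistGe5⇒¬adj H* (B-far b₁∈B b₂∈B (adj⇒≢ H* e)) e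

  B-noCommonNbr : ∀ {b₁ b₂ x} → b₁ ∈ B → b₂ ∈ B → adj H* b₁ x ≡ true → adj H* x b₂ ≡ true → b₁ ≡ b₂
  B-noCommonNbr {b₁} {b₂} b₁∈B b₂∈B e₁ e₂ with b₁ ≟ᶠ b₂
  ... | yes b₁≡b₂ = b₁≡b₂
  ... | no  b₁≢b₂ = ⊥-elim (DistGe5⇒¬commonNbr H* (B-far b₁∈B b₂∈B b₁≢b₂) e₁ e₂)

  N[B]-one-nbr-in-B : ∀ {x} → x ∈ N[B] → ∃[ b ] ∀ {y} → adj H* x y ≡ true → y ∈ B → y ≡ b
  N[B]-one-nbr-in-B {x} x∈ with ∈ClosedNbr⁻ H* x∈
  ... | inj₁ x∈B           = x , λ e y∈B → ⊥-elim (B-independent x∈B y∈B e)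
  ... | inj₂ (b , b∈B , e) = b , λ e′ y∈B → sym (B-noCommonNbr b∈B y∈B e e′)

  N[B]-robust : ∀ {x} → x ∈ N[B] → (InS H* x × (∀ y → y ∈ Nbr H* x → InS H* y)) × 5 ≤ deg H* x
  N[B]-robust = proj₁ sapphire _

  N[N[B]] : Subset n
  N[N[B]] = ClosedNbr H* N[B]

  N[N[B]]⊆S* : ∀ {x} → x ∈ N[N[B]] → InS H* x
  N[N[B]]⊆S* {x} x∈ with ∈ClosedNbr⁻ H* x∈
  ... | inj₁ x∈N[B]          = proj₁ (proj₁ (N[B]-robust x∈N[B]))
  ... | inj₂ (z , z∈N[B] , e) = proj₂ (proj₁ (N[B]-robust z∈N[B])) x (∈Nbr⁺ H* e)

  N[B]⊆N[N[B]] : N[B] ⊆ N[N[B]]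
  N[B]⊆N[N[B]] x∈ = x∈p∪q⁺ (inj₁ x∈)

  B⊆N[B] : B ⊆ N[B]
  B⊆N[B] x∈ = x∈p∪q⁺ (inj₁ x∈)

  Lift : Subset n → Subset n
  Lift U = (U ∩ ∁ (B′ H A B)) ∪ A′ H A B

  ∈Lift⁺ : ∀ {U x} → x ∈ U → x ∉ B′ H A B → x ∈ Lift U
  ∈Lift⁺ x∈U x∉B′ = x∈p∪q⁺ (inj₁ (x∈p∖q⁺ x∈U x∉B′))

  ∈Lift⁻ : ∀ {U x} → x ∈ Lift U → (x ∈ U × x ∉ B′ H A B) ⊎ x ∈ A′ H A B
  ∈Lift⁻ {U} x∈ = Sum.map₁ (x∈p∖q⁻ U (B′ H A B)) (x∈p∪q⁻ _ _ x∈)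

  ∈Lift∧∉A⇒∈U : ∀ {U x} → x ∈ Lift U → x ∉ A → x ∈ U
  ∈Lift∧∉A⇒∈U x∈ x∉A with ∈Lift⁻ x∈
  ... | inj₁ (x∈U , _) = x∈U
  ... | inj₂ x∈A′      = ⊥-elim (x∉A (proj₁ (∈A′⁻ H A B x∈A′)))

  module _ {U : Subset n} (coreU : StrongCoreProp H* U) (N[N[B]]⊆U : N[N[B]] ⊆ U) where

    A′-has-4-nbrs-in-Lift : ∀ {x} → x ∈ A′ H A B → 4 ≤ ∣ Nbr H x ∩ Lift U ∣
    A′-has-4-nbrs-in-Lift {x} x∈A′ with ∈A′⁻ H A B x∈A′
    ... | x∈A , 4≤deg , nbr∈Beq1 =
      ≤-trans 4≤deg (p⊆q⇒∣p∣≤∣q∣ λ y∈ → x∈p∩q⁺ (y∈ , nbr∈Lift (∈Nbr⁻ H y∈)))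
      where
      nbr∈Lift : ∀ {y} → adj H x y ≡ true → y ∈ Lift U
      nbr∈Lift {y} e with ∈Beq1⁻ H A B (nbr∈Beq1 e)
      ... | y∈B , ∣NA∣≡1 = ∈Lift⁺ (N[N[B]]⊆U (N[B]⊆N[N[B]] (B⊆N[B] y∈B))) y∉B′
        where
        y∉B′ : y ∉ B′ H A B
        y∉B′ y∈B′ with ∈NbrSet⁻ H y∈B′
        ... | _ , z , z∈A∖A′ , e′ with x∈p∖q⁻ A (A′ H A B) z∈A∖A′
        ... | z∈A , z∉A′ with ∣p∣≤1∧x∈p∧y∈p⇒x≡y (≤-reflexive ∣NA∣≡1)
                               (x∈p∩q⁺ (∈Nbr⁺ H (adj-sym H e) , x∈A))
                               (x∈p∩q⁺ (∈Nbr⁺ H (adj-sym H e′) , z∈A))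
        ... | refl = z∉A′ x∈A′

    A∖A′-∉-ClosedNbr-Lift : ∀ {x} → x ∈ A → x ∉ A′ H A B → x ∉ ClosedNbr H (Lift U)
    A∖A′-∉-ClosedNbr-Lift {x} x∈A x∉A′ x∈ with ∈ClosedNbr⁻ H x∈
    ... | inj₁ x∈Lift with ∈Lift⁻ x∈Lift
    ... | inj₁ (x∈U , _) = StrongCoreProp⇒has-nbr H* coreU (x∈p∪q⁺ (inj₁ x∈U)) (A-isolated x x∈A)
    ... | inj₂ x∈A′      = x∉A′ x∈A′
    A∖A′-∉-ClosedNbr-Lift {x} x∈A x∉A′ x∈ | inj₂ (z , z∈Lift , e) with adj-A⇒∈B (adj-sym H e) x∈A
    ... | z∈B with ∈Lift⁻ z∈Lift
    ... | inj₂ z∈A′      = A∩B≡∅ z (proj₁ (∈A′⁻ H A B z∈A′)) z∈B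
    ... | inj₁ (_ , z∉B′) = z∉B′ (∈NbrSet⁺ H z∉A∖A′ (x∈p∖q⁺ x∈A x∉A′) (adj-sym H e))
      where
      z∉A∖A′ : z ∉ A ∩ ∁ (A′ H A B)
      z∉A∖A′ z∈A∖A′ = A∩B≡∅ z (proj₁ (x∈p∖q⁻ A (A′ H A B) z∈A∖A′)) z∈B

    N[B]-has-4-nbrs-in-Lift : ∀ {x} → x ∈ N[B] → 4 ≤ ∣ Nbr H x ∩ Lift U ∣
    N[B]-has-4-nbrs-in-Lift {x} x∈N[B] with N[B]-one-nbr-in-B x∈N[B]
    ... | b , unique = ≤-pred (≤-trans (proj₂ (N[B]-robust x∈N[B])) (p⊆⁅x⁆∪q⇒∣p∣≤1+∣q∣ b nbrs⊆))
      where
      nbrs⊆ : Nbr H* x ⊆ ⁅ b ⁆ ∪ (Nbr H x ∩ Lift U)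
      nbrs⊆ {y} y∈ with ∈Nbr⁻ H* y∈ | y ∈? B′ H A B
      ... | e | yes y∈B′ rewrite unique e (B′⊆B y∈B′) = x∈p∪q⁺ (inj₁ (x∈⁅x⁆ b))
      ... | e | no  y∉B′ = x∈p∪q⁺ (inj₂ (x∈p∩q⁺
        (∈Nbr⁺ H (H*⊆H e) , ∈Lift⁺ (N[N[B]]⊆U (∈ClosedNbr H* x∈N[B] e)) y∉B′)))

    far-has-4-nbrs-in-Lift : ∀ {x} → x ∉ A → x ∉ N[B] → x ∈ ClosedNbr H (Lift U) →
                             4 ≤ ∣ Nbr H x ∩ Lift U ∣
    far-has-4-nbrs-in-Lift {x} x∉A x∉N[B] x∈ = ≤-trans (coreU x x∈ClosedNbr*U) (p⊆q⇒∣p∣≤∣q∣ nbr∈Lift)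
      where
      x∉B : x ∉ B
      x∉B = x∉N[B] ∘ B⊆N[B]
      x∈ClosedNbr*U : x ∈ ClosedNbr H* U
      x∈ClosedNbr*U with ∈ClosedNbr⁻ H x∈
      ... | inj₁ x∈Lift = x∈p∪q⁺ (inj₁ (∈Lift∧∉A⇒∈U x∈Lift x∉A))
      ... | inj₂ (z , z∈Lift , e) =
        ∈ClosedNbr H* (∈Lift∧∉A⇒∈U z∈Lift (adj*⇒∉A (adj-sym H* e*))) (adj-sym H* e*)
        where e* = adj⇒adj*-∉A∪B (adj-sym H e) x∉A x∉B
      nbr∈Lift : Nbr H* x ∩ U ⊆ Nbr H x ∩ Lift U
      nbr∈Lift {y} y∈ with x∈p∩q⁻ (Nbr H* x) U y∈
      ... | y∈N , y∈U = x∈p∩q⁺ (∈Nbr⁺ H (H*⊆H e) , ∈Lift⁺ y∈U y∉B′)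
        where
        e = ∈Nbr⁻ H* y∈N
        y∉B′ : y ∉ B′ H A B
        y∉B′ y∈B′ = x∉N[B] (x∈p∪q⁺ (inj₂ (∈NbrSet⁺ H* x∉B (B′⊆B y∈B′) (adj-sym H* e))))

    StrongCoreProp-Lift : StrongCoreProp H (Lift U)
    StrongCoreProp-Lift x x∈ with x ∈? A | x ∈? N[B]
    ... | no  x∉A | yes x∈N[B] = N[B]-has-4-nbrs-in-Lift x∈N[B]
    ... | no  x∉A | no  x∉N[B] = far-has-4-nbrs-in-Lift x∉A x∉N[B] x∈
    ... | yes x∈A | _ with x ∈? A′ H A B
    ...   | yes x∈A′ = A′-has-4-nbrs-in-Lift x∈A′
    ...   | no  x∉A′ = ⊥-elim (A∖A′-∉-ClosedNbr-Lift x∈A x∉A′ x∈)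

    Lift⊆S : ∀ {x} → x ∈ Lift U → InS H x
    Lift⊆S x∈ = Lift U , StrongCoreProp-Lift , x∈

  N[N[B]]-cover : Σ (Subset n) λ U → StrongCoreProp H* U × N[N[B]] ⊆ U
  N[N[B]]-cover = InS-cover H* N[N[B]] N[N[B]]⊆S*

  S*∖B′∪A′⊆S : ∀ x → (InS H* x × x ∉ B′ H A B) ⊎ x ∈ A′ H A B → InS H x
  S*∖B′∪A′⊆S x x∈ with N[N[B]]-cover | x∈
  ... | U , coreU , N[N[B]]⊆U | inj₂ x∈A′ = Lift⊆S coreU N[N[B]]⊆U (x∈p∪q⁺ (inj₂ x∈A′))
  ... | U , coreU , N[N[B]]⊆U | inj₁ ((X , coreX , x∈X) , x∉B′) =
    Lift⊆S (StrongCoreProp-∪ H* coreX coreU) (λ y∈N² → x∈p∪q⁺ (inj₂ (N[N[B]]⊆U y∈N²)))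
           (∈Lift⁺ (x∈p∪q⁺ (inj₁ x∈X)) x∉B′)

  N[N[B]]∖B′⊆S : ∀ {x} → x ∈ N[N[B]] → x ∉ B′ H A B → InS H x
  N[N[B]]∖B′⊆S x∈N² x∉B′ with N[N[B]]-cover
  ... | U , coreU , N[N[B]]⊆U = Lift⊆S coreU N[N[B]]⊆U (∈Lift⁺ (N[N[B]]⊆U x∈N²) x∉B′)

  deg*≤deg : ∀ {x} → deg H* x ≤ deg H x
  deg*≤deg = p⊆q⇒∣p∣≤∣q∣ (∈Nbr⁺ H ∘ H*⊆H ∘ ∈Nbr⁻ H*)

  Sheltered : Fin n → Set
  Sheltered x = x ∈ N[B] × x ∉ B′ H A B × (∀ {y} → adj H x y ≡ true → adj H* x y ≡ true × y ∉ B′ H A B)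

  Sheltered⇒robust : ∀ {x} → Sheltered x → (InS H x × (∀ y → y ∈ Nbr H x → InS H y)) × 5 ≤ deg H x
  Sheltered⇒robust {x} (x∈N[B] , x∉B′ , nbrs) =
    (N[N[B]]∖B′⊆S (N[B]⊆N[N[B]] x∈N[B]) x∉B′ , nbr∈S) , ≤-trans (proj₂ (N[B]-robust x∈N[B])) deg*≤deg
    where
    nbr∈S : ∀ y → y ∈ Nbr H x → InS H y
    nbr∈S y y∈ with nbrs (∈Nbr⁻ H y∈)
    ... | e* , y∉B′ = N[N[B]]∖B′⊆S (∈ClosedNbr H* x∈N[B] e*) y∉B′

  B₀ : Subset n
  B₀ = B ∩ ∁ (NbrSet H A)

  B₀-sheltered : ∀ {x} → x ∈ B₀ → Sheltered x
  B₀-sheltered {x} x∈B₀ with x∈p∖q⁻ B (NbrSet H A) x∈B₀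
  ... | x∈B , x∉NA = B⊆N[B] x∈B , x∉NA ∘ B′⊆NbrSet-A , nbrs
    where
    x∉A : x ∉ A
    x∉A x∈A = A∩B≡∅ x x∈A x∈B
    nbrs : ∀ {y} → adj H x y ≡ true → adj H* x y ≡ true × y ∉ B′ H A B
    nbrs e = e* , λ y∈B′ → B-independent x∈B (B′⊆B y∈B′) e*
      where
      e* = adj⇒adj*-∉A e x∉A (λ y∈A → x∉NA (∈NbrSet⁺ H x∉A y∈A (adj-sym H e)))

  NbrSet-B₀-sheltered : ∀ {x} → x ∈ NbrSet H B₀ → Sheltered x
  NbrSet-B₀-sheltered {x} x∈ with ∈NbrSet⁻ H x∈
  ... | _ , b , b∈B₀ , e with x∈p∖q⁻ B (NbrSet H A) b∈B₀
  ... | b∈B , b∉NA = x∈p∪q⁺ (inj₂ (∈NbrSet⁺ H* x∉B b∈B e*)) , x∉B ∘ B′⊆B , nbrs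
    where
    b∉A : b ∉ A
    b∉A b∈A = A∩B≡∅ b b∈A b∈B
    x∉A : x ∉ A
    x∉A x∈A = b∉NA (∈NbrSet⁺ H b∉A x∈A (adj-sym H e))
    e* = adj⇒adj*-∉A e b∉A x∉A
    x∉B : x ∉ B
    x∉B x∈B = B-independent b∈B x∈B e*
    nbrs : ∀ {y} → adj H x y ≡ true → adj H* x y ≡ true × y ∉ B′ H A B
    nbrs {y} e′ = e′* , y∉B′
      where
      e′* = adj⇒adj*-∉A∪B e′ x∉A x∉B
      y∉B′ : y ∉ B′ H A B
      y∉B′ y∈B′ with B-noCommonNbr b∈B (B′⊆B y∈B′) e* e′*
      ... | refl = b∉NA (B′⊆NbrSet-A y∈B′)

  B₀-robust : ∀ x → x ∈ ClosedNbr H B₀ → (InS H x × (∀ y → y ∈ Nbr H x → InS H y)) × 5 ≤ deg H x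
  B₀-robust x x∈ = Sheltered⇒robust ([ B₀-sheltered , NbrSet-B₀-sheltered ] (x∈p∪q⁻ B₀ (NbrSet H B₀) x∈))

  Walk-H⇒Walk-H*⊎reaches-NbrSet-A : ∀ {k x v} → x ∉ A → Walk H k x v →
    Walk H* k x v ⊎ Σ ℕ λ j → j < k × ∃[ b ] Walk H* j x b × b ∈ NbrSet H A
  Walk-H⇒Walk-H*⊎reaches-NbrSet-A x∉A here = inj₁ here
  Walk-H⇒Walk-H*⊎reaches-NbrSet-A {x = x} x∉A (step {y = y} e w) with y ∈? A
  ... | yes y∈A = inj₂ (0 , s≤s z≤n , x , here , ∈NbrSet⁺ H x∉A y∈A (adj-sym H e))
  ... | no  y∉A with Walk-H⇒Walk-H*⊎reaches-NbrSet-A y∉A w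
  ...   | inj₁ w*                       = inj₁ (step (adj⇒adj*-∉A e x∉A y∉A) w*)
  ...   | inj₂ (j , j<k , b , w* , b∈NA) =
    inj₂ (suc j , s≤s j<k , b , step (adj⇒adj*-∉A e x∉A y∉A) w* , b∈NA)

  B₀-far : ∀ b₁ b₂ → b₁ ∈ B₀ → b₂ ∈ B₀ → b₁ ≢ b₂ → DistGe5 H b₁ b₂
  B₀-far b₁ b₂ b₁∈ b₂∈ b₁≢b₂ k k≤4 w
    with x∈p∖q⁻ B (NbrSet H A) b₁∈ | x∈p∖q⁻ B (NbrSet H A) b₂∈
  ... | b₁∈B , b₁∉NA | b₂∈B , _ with Walk-H⇒Walk-H*⊎reaches-NbrSet-A (λ b₁∈A → A∩B≡∅ b₁ b₁∈A b₁∈B) w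
  ... | inj₁ w* = B-far b₁∈B b₂∈B b₁≢b₂ k k≤4 w*
  ... | inj₂ (j , j<k , b , w* , b∈NA) with b₁ ≟ᶠ b
  ...   | yes refl = b₁∉NA b∈NA
  ...   | no  b₁≢b = B-far b₁∈B (NbrSet-A⊆B (λ a∈ → a∈) b∈NA) b₁≢b j (≤-trans (<⇒≤ j<k) k≤4) w*

proposition6p5 :
    (n : ℕ) (H* H : Graph n) (A B : Subset n) (F : Fin n → Fin n → Bool) →
    (∀ x → x ∈ A → x ∉ B) →
    (∀ a → a ∈ A → ∀ y → adj H* a y ≡ false) →
    RobustSapphire H* B →
    (∀ x y → F x y ≡ true → x ∈ A × y ∈ B) →
    (∀ x y → adj H x y ≡ (adj H* x y ∨ F x y ∨ F y x)) →
    (∀ x → (InS H* x × x ∉ B′ H A B) ⊎ x ∈ A′ H A B → InS H x)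
    × RobustSapphire H (B ∩ ∁ (NbrSet H A))
proposition6p5 n H* H A B F A∩B≡∅ A-isolated sapphire F⊆A×B H≡H*∪F =
  S*∖B′∪A′⊆S , B₀-robust , B₀-far
  where
  new-edge : ∀ {x y} → adj H x y ≡ true → adj H* x y ≡ true ⊎ (x ∈ A × y ∈ B) ⊎ (y ∈ A × x ∈ B)
  new-edge {x} {y} e = Sum.map₂ (Sum.map (F⊆A×B x y) (F⊆A×B y x)) (adj-∪⁻ H* H F H≡H*∪F e)
  open Augmentation H* H A B A∩B≡∅ A-isolated sapphire (adj-∪ˡ H* H F H≡H*∪F) new-edge
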